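{- Let $n \ge 1$ be an integer and consider the algorithm $\textsf{optimal\_uniform}(n)$ run with independent fair coin flips: (1) set $m \leftarrow 1$, $X \leftarrow 1$; (2) while $m < n$: (3) draw a fair coin flip $B$ uniform on $\{0,1\}$, independent of everything before; (4) set $X \leftarrow X + Bm$ and $m \leftarrow 2m$; (5) if $m \ge n$ and $X \le n$ then set $m \leftarrow n$; (6) if $m \ge n$ and $X > n$ then set $X \leftarrow X - n$ and $m \leftarrow m - n$; (7) return $X$. Then at the end of each line of the algorithm, the state $(X, m)$ satisfies: conditional on the value of $m$, $X$ is uniformly distributed on $\{1, \ldots, m\}$.
   Formalization: Uniformity of X given m is claimed after lines (5) and (6) executed together as one if/else step, not at the end of line (5) alone. The statement above fails without it. -}

module Defs where

open import Data.Bool using (Bool; true; false; if_then_else_)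
open import Data.Nat using (ℕ; zero; suc; _+_; _*_; _∸_; _<ᵇ_; _≤ᵇ_)
open import Data.Nat.Properties using () renaming (_≟_ to _≟ℕ_)
open import Data.Product using (_×_; _,_; proj₁; proj₂)
open import Data.Maybe using (Maybe; just; nothing)
open import Data.List using (List; []; _∷_; length; filter; map; _++_)
open import Data.Vec using (Vec; []; _∷_; toList; init; last)
import Data.Maybe.Properties as MaybeP
import Data.Product.Properties as ProdP
open import Relation.Binary.PropositionalEquality using (_≡_)
open import Relation.Binary.Definitions using (DecidableEquality)

State : Set
State = ℕ × ℕ

X-of : State → ℕ
X-of = proj₁

m-of : State → ℕ
m-of = proj₂

initState : State
initState = (1 , 1)

step4 : Bool → State → State
step4 b (x , m) = (x + (if b then m else 0) , 2 * m)

step5 : ℕ → State → State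
step5 n (x , m) = if (n ≤ᵇ m) Data.Bool.∧ (x ≤ᵇ n) then (x , n) else (x , m)

step6 : ℕ → State → State
step6 n (x , m) = if (n ≤ᵇ m) Data.Bool.∧ (n <ᵇ x) then (x ∸ n , m ∸ n) else (x , m)

iter : ℕ → Bool → State → State
iter n b s = step6 n (step5 n (step4 b s))

-- Returns nothing if the
-- loop would have exited before consuming all flips.
runFrom : ℕ → State → List Bool → Maybe State
runFrom n s [] = just s
runFrom n s (b ∷ bs) = if m-of s <ᵇ n then runFrom n (iter n b s) bs else nothing

after : ℕ → List Bool → Maybe State
after n bs = runFrom n initState bs

enter : ℕ → Maybe State → Maybe State
enter n nothing = nothing
enter n (just s) = if m-of s <ᵇ n then just s else nothing

exit : ℕ → Maybe State → Maybe State
exit n nothing = nothing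
exit n (just s) = if m-of s <ᵇ n then nothing else just s

mapM : (State → State) → Maybe State → Maybe State
mapM f nothing = nothing
mapM f (just s) = just (f s)

data Point : Set where
  l1 l2 l3 l4 l56 l7 : Point

-- State at a program point, as a function of ALL coin flips drawn so far
-- (a vector of length k).  'nothing' = this point is not reached at that
-- moment along this coin sequence.
--  l1  : end of line (1)            (k = 0)
--  l2  : end of line (2) in iteration k+1 (k flips drawn before it)
--  l3  : end of line (3) in iteration k (the k-th flip just drawn), k ≥ 1
--  l4  : end of line (4) in iteration k
--  l56 : end of lines (5),(6) in iteration k
--  l7  : end of line (7), the loop having exited after exactly k iterations
stateAt : ℕ → Point → {k : ℕ} → Vec Bool k → Maybe State
stateAt n l1 [] = just initState
stateAt n l1 (_ ∷ _) = nothing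
stateAt n l2 bs = enter n (after n (toList bs))
stateAt n l3 {zero} bs = nothing
stateAt n l3 {suc k} bs = enter n (after n (toList (init bs)))
stateAt n l4 {zero} bs = nothing
stateAt n l4 {suc k} bs = mapM (step4 (last bs)) (enter n (after n (toList (init bs))))
stateAt n l56 {zero} bs = nothing
stateAt n l56 {suc k} bs =
  mapM (λ s → step6 n (step5 n (step4 (last bs) s))) (enter n (after n (toList (init bs))))
stateAt n l7 bs = exit n (after n (toList bs))

allVecs : (k : ℕ) → List (Vec Bool k)
allVecs zero = [] ∷ []
allVecs (suc k) = map (true ∷_) (allVecs k) ++ map (false ∷_) (allVecs k)

_≟S_ : DecidableEquality (Maybe State)
_≟S_ = MaybeP.≡-dec (ProdP.≡-dec _≟ℕ_ _≟ℕ_)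

-- number of length-k coin sequences (out of 2^k, all equally likely) along
-- which the state at point p equals (x , m)
count : ℕ → Point → (k : ℕ) → ℕ → ℕ → ℕ
count n p k x m = length (filter (λ bs → stateAt n p bs ≟S just (x , m)) (allVecs k))

{-# OPTIONS --safe #-}

-- A multiset of states is handled through the functional g ↦ Σ g(state) on test functions
-- g : State → ℕ, summed over all coin sequences (a point that is not reached contributes 0).
-- Call {(1 , M) , … , (M , M)} the uniform block of level M. Each line of the algorithm maps
-- a block to a union of blocks: the while-test keeps or drops it, lines (3)–(4) turn block M
-- into block 2M (B = 0 gives X ≤ M, B = 1 gives X > M), and lines (5)–(6) cut a block M ≥ n
-- into the blocks n and M − n. The start state is block 1, so at every program point the
-- states form a union of blocks. Hence the number of runs reaching (x , m) is the number of
-- blocks of level m, whatever 1 ≤ x ≤ m, and every reached state satisfies 1 ≤ x ≤ m.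
module Submission where

open import Defs
open import Data.Bool using (Bool; true; false; if_then_else_; not)
open import Data.Bool.Properties using (∧-zeroʳ)
open import Data.List using (List; []; _∷_; _++_; [_]; map; concatMap; filter; length)
open import Data.List.Properties using (map-cong; map-++; map-∘)
open import Data.List.Membership.Propositional using (_∈_)
open import Data.List.Membership.Propositional.Properties using (∈-map⁺; ∈-++⁺ˡ; ∈-++⁺ʳ)
open import Data.List.Relation.Unary.Any using (here; there)
open import Data.Maybe using (Maybe; just; nothing; maybe′)
open import Data.Nat using (ℕ; zero; suc; _+_; _*_; _∸_; _≤_; _<_; _≤ᵇ_; _<ᵇ_; s≤s; z≤n)
open import Data.Nat.Properties
open import Algebra.Properties.CommutativeSemigroup +-commutativeSemigroup using (interchange)
open import Data.Nat.ListAction using (sum)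
open import Data.Nat.ListAction.Properties using (sum-++)
open import Data.Product using (_×_; _,_; proj₁; proj₂; ∃-syntax)
import Data.Product.Properties as Product
open import Data.Vec using (Vec; []; _∷_; toList; init; last; _∷ʳ_)
open import Data.Vec.Properties using (init-∷ʳ; last-∷ʳ; toList-∷ʳ)
open import Function using (_∘_; _⇔_; mk⇔)
open import Relation.Binary.PropositionalEquality hiding ([_])
open import Relation.Nullary using (Dec; does; ¬_; yes; no; contradiction)
open import Relation.Nullary.Decidable using (dec-true; dec-false; does-⇔; _×-dec_)

private
  variable
    P Q : Set
    m x y : ℕ

𝟙 : Dec P → ℕ
𝟙 P? = if does P? then 1 else 0

𝟙-yes : P → (P? : Dec P) → 𝟙 P? ≡ 1
𝟙-yes p P? = cong (if_then 1 else 0) (dec-true P? p)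

𝟙-no : ¬ P → (P? : Dec P) → 𝟙 P? ≡ 0
𝟙-no ¬p P? = cong (if_then 1 else 0) (dec-false P? ¬p)

𝟙-⇔ : P ⇔ Q → (P? : Dec P) (Q? : Dec Q) → 𝟙 P? ≡ 𝟙 Q?
𝟙-⇔ P⇔Q P? Q? = cong (if_then 1 else 0) (does-⇔ P⇔Q P? Q?)

length-filter≡sum-𝟙 : {A : Set} {P : A → Set} (P? : ∀ a → Dec (P a)) (xs : List A) →
  length (filter P? xs) ≡ sum (map (𝟙 ∘ P?) xs)
length-filter≡sum-𝟙 P? [] = refl
length-filter≡sum-𝟙 P? (a ∷ xs) with does (P? a)
... | true  = cong suc (length-filter≡sum-𝟙 P? xs)
... | false = length-filter≡sum-𝟙 P? xs

sum-map-zero : {A : Set} {f : A → ℕ} → (∀ a → f a ≡ 0) → (xs : List A) → sum (map f xs) ≡ 0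
sum-map-zero f≡0 [] = refl
sum-map-zero f≡0 (a ∷ xs) = cong₂ _+_ (f≡0 a) (sum-map-zero f≡0 xs)

∈⇒≤sum-map : {A : Set} {a : A} {xs : List A} (f : A → ℕ) → a ∈ xs → f a ≤ sum (map f xs)
∈⇒≤sum-map f (here refl) = m≤m+n _ _
∈⇒≤sum-map f (there a∈xs) = ≤-trans (∈⇒≤sum-map f a∈xs) (m≤n+m _ _)

∑< : ℕ → (ℕ → ℕ) → ℕ
∑< zero    f = 0
∑< (suc M) f = f 0 + ∑< M (f ∘ suc)

syntax ∑< M (λ i → e) = ∑[ i < M ] e

∑-cong : ∀ M {f g : ℕ → ℕ} → (∀ i → i < M → f i ≡ g i) → ∑< M f ≡ ∑< M g
∑-cong zero    f≡g = refl
∑-cong (suc M) f≡g = cong₂ _+_ (f≡g 0 (s≤s z≤n)) (∑-cong M (λ i i<M → f≡g (suc i) (s≤s i<M)))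

∑-zero : ∀ M → ∑[ i < M ] 0 ≡ 0
∑-zero zero    = refl
∑-zero (suc M) = ∑-zero M

∑-distrib-+ : ∀ M (f g : ℕ → ℕ) → ∑[ i < M ] (f i + g i) ≡ ∑< M f + ∑< M g
∑-distrib-+ zero    f g = refl
∑-distrib-+ (suc M) f g = trans (cong (f 0 + g 0 +_) (∑-distrib-+ M (f ∘ suc) (g ∘ suc)))
                                (interchange (f 0) (g 0) _ _)

∑-split : ∀ a b (f : ℕ → ℕ) → ∑< (a + b) f ≡ ∑< a f + ∑[ i < b ] f (a + i)
∑-split zero    b f = refl
∑-split (suc a) b f = trans (cong (f 0 +_) (∑-split a b (f ∘ suc))) (sym (+-assoc (f 0) _ _))

∑-𝟙-none : ∀ M {P : ℕ → Set} (P? : ∀ i → Dec (P i)) →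
  (∀ i → i < M → ¬ P i) → ∑[ i < M ] 𝟙 (P? i) ≡ 0
∑-𝟙-none M P? ¬P = trans (∑-cong M (λ i i<M → 𝟙-no (¬P i i<M) (P? i))) (∑-zero M)

∑-𝟙-≟ : ∀ {M j} → j < M → ∑[ i < M ] 𝟙 (i ≟ j) ≡ 1
∑-𝟙-≟ {suc M} {zero}  _         = cong suc (∑-𝟙-none M (λ i → suc i ≟ 0) (λ i _ ()))
∑-𝟙-≟ {suc M} {suc j} (s≤s j<M) = ∑-𝟙-≟ j<M

sum-allVecs-∷ : ∀ k (φ : Vec Bool (suc k) → ℕ) →
  sum (map φ (allVecs (suc k)))
    ≡ sum (map (φ ∘ (true ∷_)) (allVecs k)) + sum (map (φ ∘ (false ∷_)) (allVecs k))
sum-allVecs-∷ k φ = begin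
  sum (map φ (map (true ∷_) A ++ map (false ∷_) A))
    ≡⟨ cong sum (map-++ φ (map (true ∷_) A) _) ⟩
  sum (map φ (map (true ∷_) A) ++ map φ (map (false ∷_) A))
    ≡⟨ sum-++ (map φ (map (true ∷_) A)) _ ⟩
  sum (map φ (map (true ∷_) A)) + sum (map φ (map (false ∷_) A))
    ≡⟨ cong₂ _+_ (cong sum (map-∘ A)) (cong sum (map-∘ A)) ⟨
  sum (map (φ ∘ (true ∷_)) A) + sum (map (φ ∘ (false ∷_)) A) ∎
  where
  open ≡-Reasoning
  A = allVecs k

-- allVecs is built by prepending flips, whereas the program points are indexed by the last flip.
sum-allVecs-∷ʳ : ∀ k (φ : Vec Bool (suc k) → ℕ) →
  sum (map φ (allVecs (suc k))) ≡ sum (map (λ v → φ (v ∷ʳ true) + φ (v ∷ʳ false)) (allVecs k))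
sum-allVecs-∷ʳ zero    φ = sym (+-assoc (φ (true ∷ [])) (φ (false ∷ [])) 0)
sum-allVecs-∷ʳ (suc k) φ = begin
  sum (map φ (allVecs (suc (suc k))))
    ≡⟨ sum-allVecs-∷ (suc k) φ ⟩
  sum (map (φ ∘ (true ∷_)) (allVecs (suc k))) + sum (map (φ ∘ (false ∷_)) (allVecs (suc k)))
    ≡⟨ cong₂ _+_ (sum-allVecs-∷ʳ k (φ ∘ (true ∷_))) (sum-allVecs-∷ʳ k (φ ∘ (false ∷_))) ⟩
  sum (map (ψ ∘ (true ∷_)) (allVecs k)) + sum (map (ψ ∘ (false ∷_)) (allVecs k))
    ≡⟨ sum-allVecs-∷ k ψ ⟨
  sum (map ψ (allVecs (suc k))) ∎
  where
  open ≡-Reasoning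
  ψ : Vec Bool (suc k) → ℕ
  ψ v = φ (v ∷ʳ true) + φ (v ∷ʳ false)

∈-allVecs : ∀ {k} (bs : Vec Bool k) → bs ∈ allVecs k
∈-allVecs []           = here refl
∈-allVecs (true ∷ bs)  = ∈-++⁺ˡ (∈-map⁺ (true ∷_) (∈-allVecs bs))
∈-allVecs (false ∷ bs) = ∈-++⁺ʳ _ (∈-map⁺ (false ∷_) (∈-allVecs bs))

block : (State → ℕ) → ℕ → ℕ
block g M = ∑[ i < M ] g (suc i , M)

blocks : (State → ℕ) → List ℕ → ℕ
blocks g Ms = sum (map (block g) Ms)

BlockMixture : ((State → ℕ) → ℕ) → Set
BlockMixture I = ∃[ Ms ] ∀ g → I g ≡ blocks g Ms

-- T pulls test functions back along a step of the algorithm; the step sends the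
-- uniform block M onto the blocks f M.
record MapsBlocks (T : (State → ℕ) → State → ℕ) (f : ℕ → List ℕ) : Set where
  field
    block-pullback : ∀ g M → block (T g) M ≡ blocks g (f M)

open MapsBlocks

blocks-++ : ∀ g Ms Ns → blocks g (Ms ++ Ns) ≡ blocks g Ms + blocks g Ns
blocks-++ g Ms Ns = trans (cong sum (map-++ (block g) Ms Ns)) (sum-++ (map (block g) Ms) _)

blocks-concatMap : ∀ {T f} → MapsBlocks T f → ∀ g Ms → blocks (T g) Ms ≡ blocks g (concatMap f Ms)
blocks-concatMap     T↦f g []       = refl
blocks-concatMap {f = f} T↦f g (M ∷ Ms) =
  trans (cong₂ _+_ (T↦f .block-pullback g M) (blocks-concatMap T↦f g Ms)) (sym (blocks-++ g (f M) _))

mixture-∘ : ∀ {I T f} → BlockMixture I → MapsBlocks T f → BlockMixture (I ∘ T)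
mixture-∘ {T = T} {f} (Ms , I≡) T↦f =
  concatMap f Ms , λ g → trans (I≡ (T g)) (blocks-concatMap T↦f g Ms)

mixture-cong : ∀ {I J} → BlockMixture I → (∀ g → J g ≡ I g) → BlockMixture J
mixture-cong (Ms , I≡) J≡I = Ms , λ g → trans (J≡I g) (I≡ g)

_≟ₛ_ : (s t : State) → Dec (s ≡ t)
_≟ₛ_ = Product.≡-dec _≟_ _≟_

δ : State → State → ℕ
δ s t = 𝟙 (t ≟ₛ s)

block-δ-outside : ¬ (1 ≤ x × x ≤ m) → ∀ M → block (δ (x , m)) M ≡ 0
block-δ-outside {x} {m} ¬inside M = ∑-𝟙-none M (λ i → (suc i , M) ≟ₛ (x , m))
  (λ { i i<M refl → ¬inside (s≤s z≤n , i<M) })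

block-δ-inside : 1 ≤ x → x ≤ m → ∀ M → block (δ (x , m)) M ≡ 𝟙 (M ≟ m)
block-δ-inside {x} {m} _ _ M with M ≟ m
block-δ-inside {suc j} {m} _ x≤m M | yes refl = begin
  ∑[ i < M ] 𝟙 ((suc i , M) ≟ₛ (suc j , M))
    ≡⟨ ∑-cong M (λ i _ → 𝟙-⇔ (mk⇔ (suc-injective ∘ cong proj₁) (cong (λ i → suc i , M)))
                               ((suc i , M) ≟ₛ (suc j , M)) (i ≟ j)) ⟩
  ∑[ i < M ] 𝟙 (i ≟ j) ≡⟨ ∑-𝟙-≟ x≤m ⟩
  1                    ≡⟨ 𝟙-yes refl (M ≟ M) ⟨
  𝟙 (M ≟ M)            ∎
  where open ≡-Reasoning
... | no M≢m = trans (∑-𝟙-none M (λ i → (suc i , M) ≟ₛ (x , m)) (λ i _ eq → M≢m (cong proj₂ eq)))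
                     (sym (𝟙-no M≢m (M ≟ m)))

mixture⇒uniform : ∀ {I} → BlockMixture I →
  1 ≤ x → x ≤ m → 1 ≤ y → y ≤ m → I (δ (x , m)) ≡ I (δ (y , m))
mixture⇒uniform {x} {m} {y} {I} (Ms , I≡) 1≤x x≤m 1≤y y≤m = begin
  I (δ (x , m))                    ≡⟨ I≡ _ ⟩
  sum (map (block (δ (x , m))) Ms) ≡⟨ cong sum (map-cong (block-δ-inside 1≤x x≤m) Ms) ⟩
  sum (map (λ M → 𝟙 (M ≟ m)) Ms)   ≡⟨ cong sum (map-cong (block-δ-inside 1≤y y≤m) Ms) ⟨
  sum (map (block (δ (y , m))) Ms) ≡⟨ I≡ _ ⟨
  I (δ (y , m))                    ∎
  where open ≡-Reasoning

mixture⇒inside : ∀ {I} → BlockMixture I → 1 ≤ I (δ (x , m)) → 1 ≤ x × x ≤ m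
mixture⇒inside {x} {m} (Ms , I≡) 1≤I with 1 ≤? x ×-dec x ≤? m
... | yes inside = inside
... | no ¬inside = contradiction
  (trans (I≡ _) (sum-map-zero (block-δ-outside ¬inside) Ms))
  (≢-sym (<⇒≢ 1≤I))

∑-outcomes : ∀ {k} → (Vec Bool k → Maybe State) → (State → ℕ) → ℕ
∑-outcomes {k} σ g = sum (map (maybe′ g 0 ∘ σ) (allVecs k))

∑-outcomes-reached : ∀ {k} (σ : Vec Bool k → Maybe State) (bs : Vec Bool k) {s} →
  σ bs ≡ just s → 1 ≤ ∑-outcomes σ (δ s)
∑-outcomes-reached σ bs {s} σbs≡s = ≤-trans
  (≤-reflexive (sym (trans (cong (maybe′ (δ s) 0) σbs≡s) (𝟙-yes refl (s ≟ₛ s)))))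
  (∈⇒≤sum-map (maybe′ (δ s) 0 ∘ σ) (∈-allVecs bs))

≤ᵇ-true : ∀ {a b} → a ≤ b → (a ≤ᵇ b) ≡ true
≤ᵇ-true {a} {b} = dec-true (a ≤? b)

≤ᵇ-false : ∀ {a b} → ¬ a ≤ b → (a ≤ᵇ b) ≡ false
≤ᵇ-false {a} {b} = dec-false (a ≤? b)

<ᵇ-true : ∀ {a b} → a < b → (a <ᵇ b) ≡ true
<ᵇ-true {a} {b} = dec-true (a <? b)

<ᵇ-false : ∀ {a b} → ¬ a < b → (a <ᵇ b) ≡ false
<ᵇ-false {a} {b} = dec-false (a <? b)

guard : (ℕ → Bool) → (State → ℕ) → State → ℕ
guard c g (x , m) = if c m then g (x , m) else 0

guardBlocks : (ℕ → Bool) → ℕ → List ℕ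
guardBlocks c M = if c M then [ M ] else []

guard-maps : ∀ c → MapsBlocks (guard c) (guardBlocks c)
guard-maps c .block-pullback g M with c M
... | true  = sym (+-identityʳ _)
... | false = ∑-zero M

coin : (Bool → State → State) → (State → ℕ) → State → ℕ
coin G g s = g (G true s) + g (G false s)

coin-id-maps : MapsBlocks (coin (λ _ s → s)) (λ M → M ∷ M ∷ [])
coin-id-maps .block-pullback g M =
  trans (∑-distrib-+ M _ _) (cong (block g M +_) (sym (+-identityʳ _)))

coin-step4-maps : MapsBlocks (coin step4) (λ M → [ 2 * M ])
coin-step4-maps .block-pullback g M = begin
  ∑[ i < M ] (g (suc i + M , 2 * M) + g (suc i + 0 , 2 * M))
    ≡⟨ ∑-distrib-+ M _ _ ⟩
  ∑[ i < M ] g (suc i + M , 2 * M) + ∑[ i < M ] g (suc i + 0 , 2 * M)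
    ≡⟨ +-comm (∑[ i < M ] g (suc i + M , 2 * M)) _ ⟩
  ∑[ i < M ] g (suc i + 0 , 2 * M) + ∑[ i < M ] g (suc i + M , 2 * M)
    ≡⟨ cong₂ _+_ (∑-cong M (λ i _ → cong (λ j → g (suc j , 2 * M)) (+-identityʳ i)))
                 (∑-cong M (λ i _ → cong (λ j → g (suc j , 2 * M)) (+-comm i M))) ⟩
  ∑[ i < M ] g (suc i , 2 * M) + ∑[ i < M ] g (suc (M + i) , 2 * M)
    ≡⟨ ∑-split M M _ ⟨
  ∑[ i < M + M ] g (suc i , 2 * M)
    ≡⟨ cong (λ K → ∑[ i < M + K ] g (suc i , 2 * M)) (+-identityʳ M) ⟨
  block g (2 * M)
    ≡⟨ +-identityʳ _ ⟨
  blocks g [ 2 * M ] ∎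
  where open ≡-Reasoning

module _ (n : ℕ) where

  post : State → State
  post s = step6 n (step5 n s)

  step5-< : ∀ {x M} → M < n → step5 n (x , M) ≡ (x , M)
  step5-< M<n rewrite ≤ᵇ-false (<⇒≱ M<n) = refl

  step6-< : ∀ {x M} → M < n → step6 n (x , M) ≡ (x , M)
  step6-< M<n rewrite ≤ᵇ-false (<⇒≱ M<n) = refl

  step5-≤ : ∀ {x M} → n ≤ M → x ≤ n → step5 n (x , M) ≡ (x , n)
  step5-≤ n≤M x≤n rewrite ≤ᵇ-true n≤M | ≤ᵇ-true x≤n = refl

  step6-≤ : ∀ {x M} → x ≤ n → step6 n (x , M) ≡ (x , M)
  step6-≤ {M = M} x≤n rewrite <ᵇ-false (≤⇒≯ x≤n) | ∧-zeroʳ (n ≤ᵇ M) = refl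

  step5-> : ∀ {x M} → n < x → step5 n (x , M) ≡ (x , M)
  step5-> {M = M} n<x rewrite ≤ᵇ-false (<⇒≱ n<x) | ∧-zeroʳ (n ≤ᵇ M) = refl

  step6-> : ∀ {x M} → n ≤ M → n < x → step6 n (x , M) ≡ (x ∸ n , M ∸ n)
  step6-> n≤M n<x rewrite ≤ᵇ-true n≤M | <ᵇ-true n<x = refl

  post-< : ∀ {x M} → M < n → post (x , M) ≡ (x , M)
  post-< M<n = trans (cong (step6 n) (step5-< M<n)) (step6-< M<n)

  post-≤ : ∀ {x M} → n ≤ M → x ≤ n → post (x , M) ≡ (x , n)
  post-≤ n≤M x≤n = trans (cong (step6 n) (step5-≤ n≤M x≤n)) (step6-≤ x≤n)

  post-> : ∀ {j M} → n ≤ M → post (suc (n + j) , M) ≡ (suc j , M ∸ n)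
  post-> {j} {M} n≤M = begin
    step6 n (step5 n (suc (n + j) , M))  ≡⟨ cong (step6 n) (step5-> n<x) ⟩
    step6 n (suc (n + j) , M)            ≡⟨ step6-> n≤M n<x ⟩
    (suc (n + j) ∸ n , M ∸ n)            ≡⟨ cong (λ x → x ∸ n , M ∸ n) (+-suc n j) ⟨
    (n + suc j ∸ n , M ∸ n)              ≡⟨ cong (_, M ∸ n) (m+n∸m≡n n (suc j)) ⟩
    (suc j , M ∸ n)                      ∎
    where
    open ≡-Reasoning
    n<x : n < suc (n + j)
    n<x = s≤s (m≤m+n n j)

  postBlocks : ℕ → List ℕ
  postBlocks M = if M <ᵇ n then [ M ] else n ∷ M ∸ n ∷ []

  post-maps : MapsBlocks (_∘ post) postBlocks
  post-maps .block-pullback g M with M <? n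
  ... | yes M<n rewrite <ᵇ-true M<n =
    trans (∑-cong M (λ i _ → cong g (post-< M<n))) (sym (+-identityʳ _))
  ... | no M≮n rewrite <ᵇ-false M≮n = begin
    ∑[ i < M ] g (post (suc i , M))
      ≡⟨ cong (λ K → ∑[ i < K ] g (post (suc i , M))) (m+[n∸m]≡n n≤M) ⟨
    ∑[ i < n + (M ∸ n) ] g (post (suc i , M))
      ≡⟨ ∑-split n (M ∸ n) _ ⟩
    ∑[ i < n ] g (post (suc i , M)) + ∑[ j < M ∸ n ] g (post (suc (n + j) , M))
      ≡⟨ cong₂ _+_ (∑-cong n (λ i i<n → cong g (post-≤ n≤M i<n)))
                   (∑-cong (M ∸ n) (λ j _ → cong g (post-> n≤M))) ⟩
    block g n + block g (M ∸ n)
      ≡⟨ cong (block g n +_) (+-identityʳ _) ⟨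
    blocks g (n ∷ M ∸ n ∷ []) ∎
    where
    open ≡-Reasoning
    n≤M = ≮⇒≥ M≮n

  runFrom-∷ʳ : ∀ s bs b →
    runFrom n s (bs ++ [ b ]) ≡ mapM (iter n b) (enter n (runFrom n s bs))
  runFrom-∷ʳ (x , m) [] b with m <ᵇ n
  ... | true  = refl
  ... | false = refl
  runFrom-∷ʳ (x , m) (b′ ∷ bs) b with m <ᵇ n
  ... | true  = runFrom-∷ʳ (iter n b′ (x , m)) bs b
  ... | false = refl

  run : ∀ {k} → Vec Bool k → Maybe State
  run bs = after n (toList bs)

  run-∷ʳ : ∀ {k} (v : Vec Bool k) b → run (v ∷ʳ b) ≡ mapM (iter n b) (stateAt n l2 v)
  run-∷ʳ v b = trans (cong (after n) (toList-∷ʳ b v)) (runFrom-∷ʳ initState (toList v) b)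

  outcomes-∷ʳ : ∀ {k} (σ : Vec Bool (suc k) → Maybe State) (G : Bool → State → State) →
    (∀ v b → σ (v ∷ʳ b) ≡ mapM (G b) (stateAt n l2 v)) →
    ∀ g → ∑-outcomes σ g ≡ ∑-outcomes (stateAt n l2 {k}) (coin G g)
  outcomes-∷ʳ {k} σ G σ≡ g =
    trans (sum-allVecs-∷ʳ k _) (cong sum (map-cong last-flip (allVecs k)))
    where
    coin-mapM : ∀ r →
      maybe′ g 0 (mapM (G true) r) + maybe′ g 0 (mapM (G false) r) ≡ maybe′ (coin G g) 0 r
    coin-mapM nothing  = refl
    coin-mapM (just s) = refl

    last-flip : ∀ v → maybe′ g 0 (σ (v ∷ʳ true)) + maybe′ g 0 (σ (v ∷ʳ false))
                      ≡ maybe′ (coin G g) 0 (stateAt n l2 v)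
    last-flip v rewrite σ≡ v true | σ≡ v false = coin-mapM (stateAt n l2 v)

  enter-guard : ∀ g r → maybe′ g 0 (enter n r) ≡ maybe′ (guard (_<ᵇ n) g) 0 r
  enter-guard g nothing        = refl
  enter-guard g (just (x , m)) with m <ᵇ n
  ... | true  = refl
  ... | false = refl

  exit-guard : ∀ g r → maybe′ g 0 (exit n r) ≡ maybe′ (guard (not ∘ (_<ᵇ n)) g) 0 r
  exit-guard g nothing        = refl
  exit-guard g (just (x , m)) with m <ᵇ n
  ... | true  = refl
  ... | false = refl

  mapM-id : ∀ r → mapM (λ s → s) r ≡ r
  mapM-id nothing  = refl
  mapM-id (just s) = refl

  mapM-l2-∷ʳ : ∀ {k} (G : Bool → State → State) (v : Vec Bool k) b →
    mapM (G (last (v ∷ʳ b))) (stateAt n l2 (init (v ∷ʳ b))) ≡ mapM (G b) (stateAt n l2 v)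
  mapM-l2-∷ʳ G v b = cong₂ (λ c w → mapM (G c) (stateAt n l2 w)) (last-∷ʳ b v) (init-∷ʳ b v)

  mutual
    run-mixture : ∀ k → BlockMixture (∑-outcomes (run {k}))
    run-mixture zero    = [ 1 ] , λ g → sym (+-identityʳ _)
    run-mixture (suc k) = mixture-cong (iter-mixture k) (outcomes-∷ʳ (run {suc k}) (iter n) run-∷ʳ)

    l2-mixture : ∀ k → BlockMixture (∑-outcomes (stateAt n l2 {k}))
    l2-mixture k = mixture-cong (mixture-∘ (run-mixture k) (guard-maps (_<ᵇ n)))
                                (λ g → cong sum (map-cong (enter-guard g ∘ run) (allVecs k)))

    iter-mixture : ∀ k → BlockMixture (∑-outcomes (stateAt n l2 {k}) ∘ coin (iter n))
    iter-mixture k = mixture-∘ (mixture-∘ (l2-mixture k) coin-step4-maps) post-maps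

  mixture : ∀ p k → BlockMixture (∑-outcomes (stateAt n p {k}))
  mixture l1  zero    = run-mixture zero
  mixture l1  (suc k) = [] , λ g → sum-map-zero (λ { (_ ∷ _) → refl }) (allVecs (suc k))
  mixture l2  k       = l2-mixture k
  mixture l3  zero    = [] , λ g → refl
  mixture l3  (suc k) = mixture-cong (mixture-∘ (l2-mixture k) coin-id-maps)
    (outcomes-∷ʳ (stateAt n l3 {suc k}) (λ _ s → s)
                 (λ v b → trans (sym (mapM-id _)) (mapM-l2-∷ʳ (λ _ s → s) v b)))
  mixture l4  zero    = [] , λ g → refl
  mixture l4  (suc k) = mixture-cong (mixture-∘ (l2-mixture k) coin-step4-maps)
    (outcomes-∷ʳ (stateAt n l4 {suc k}) step4 (mapM-l2-∷ʳ step4))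
  mixture l56 zero    = [] , λ g → refl
  mixture l56 (suc k) = mixture-cong (iter-mixture k)
    (outcomes-∷ʳ (stateAt n l56 {suc k}) (iter n) (mapM-l2-∷ʳ (iter n)))
  mixture l7  k       = mixture-cong (mixture-∘ (run-mixture k) (guard-maps (not ∘ (_<ᵇ n))))
                                     (λ g → cong sum (map-cong (exit-guard g ∘ run) (allVecs k)))

  count≡∑-outcomes : ∀ p k x m → count n p k x m ≡ ∑-outcomes (stateAt n p {k}) (δ (x , m))
  count≡∑-outcomes p k x m =
    trans (length-filter≡sum-𝟙 _ (allVecs k)) (cong sum (map-cong (𝟙≡δ ∘ stateAt n p) (allVecs k)))
    where
    𝟙≡δ : ∀ r → 𝟙 (r ≟S just (x , m)) ≡ maybe′ (δ (x , m)) 0 r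
    𝟙≡δ nothing  = refl
    𝟙≡δ (just s) = refl

lemma1 : (n : ℕ) → 1 ≤ n → (p : Point) → (k : ℕ) →
    ((bs : Vec Bool k) → (x m : ℕ) → stateAt n p bs ≡ just (x , m) → 1 ≤ x × x ≤ m)
    × ((m x y : ℕ) → 1 ≤ x → x ≤ m → 1 ≤ y → y ≤ m → count n p k x m ≡ count n p k y m)
-- The block decomposition holds for every n.
lemma1 n _ p k =
  (λ bs x m reached →
    mixture⇒inside (mixture n p k) (∑-outcomes-reached (stateAt n p) bs reached)) ,
  (λ m x y 1≤x x≤m 1≤y y≤m → begin
    count n p k x m                           ≡⟨ count≡∑-outcomes n p k x m ⟩
    ∑-outcomes (stateAt n p {k}) (δ (x , m)) ≡⟨ mixture⇒uniform (mixture n p k) 1≤x x≤m 1≤y y≤m ⟩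
    ∑-outcomes (stateAt n p {k}) (δ (y , m)) ≡⟨ count≡∑-outcomes n p k y m ⟨
    count n p k y m                           ∎)
  where open ≡-Reasoning
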